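{- Let $q$ be a prime power, $n$ a positive integer and $F=\mathbb{F}_{q^{2n+1}}$. Consider the projective space $\mathrm{PG}(4n+1,q)$ whose points are the $1$-dimensional $\mathbb{F}_q$-subspaces of the $(4n+2)$-dimensional $\mathbb{F}_q$-vector space $F\times F$; write $P(a,b)$ for the point spanned by $(a,b)\ne(0,0)$. Let $\Pi_1=\{P(0,b):b\in F^*\}$, $\Pi_2=\{P(a,0):a\in F^*\}$ and, for $\omega\in F^*$, $\mathcal{V}_\omega=\{P(x^2,\omega x^{q+1}):x\in F^*\}$. Let $\eta$ be a primitive element of $F$ and let $\phi$ be the projectivity induced by the $\mathbb{F}_q$-linear map $(a,b)\mapsto(\eta^2a,\eta^{q+1}b)$. Then: (i) $|\mathcal{V}_\omega|=\frac{q^{2n+1}-1}{q-1}$ for every $\omega\in F^*$; (ii) $\langle\phi\rangle$ is a group of order $\frac{q^{2n+1}-1}{q-1}$ acting regularly on the points of $\Pi_1$, on the points of $\Pi_2$, and on the points of $\mathcal{V}_\omega$ for every $\omega\in F^*$; (iii) for $\delta,\omega\in F^*$, the projectivity induced by $(a,b)\mapsto(a,\delta b)$ maps $\mathcal{V}_\omega$ to $\mathcal{V}_{\delta\omega}$ and fixes $\Pi_1$ and $\Pi_2$. -}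

module Defs where

open import Level using (0ℓ)
open import Data.Nat as ℕ using (ℕ; zero; suc; NonZero; _∸_; _/_)
open import Data.Nat.Properties as ℕP using ()
open import Data.Nat.Primality using (Prime; prime; prime⇒nonZero)
open import Data.Fin using (Fin)
open import Data.Product using (Σ; ∃; ∃-syntax; _×_; _,_)
open import Function.Bundles using (_↔_)
open import Relation.Nullary using (¬_)
open import Relation.Binary.PropositionalEquality using (_≡_; _≢_; refl; subst)
open import Algebra.Core using (Op₁; Op₂)
open import Algebra.Structures using (IsCommutativeRing)

IsPrimePower : ℕ → Set
IsPrimePower q = Σ ℕ λ p → Σ ℕ λ k → Prime p × q ≡ p ℕ.^ suc k

private
  two≤⇒nz : ∀ m → 2 ℕ.≤ m → NonZero (m ∸ 1)
  two≤⇒nz (suc (suc r)) _ = _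
  two≤⇒nz (suc zero) (ℕ.s≤s ())

primePower⇒nz : ∀ {q} → IsPrimePower q → NonZero (q ∸ 1)
primePower⇒nz (p , k , pr@(prime _) , refl) =
  two≤⇒nz (p ℕ.^ suc k)
    (ℕP.*-mono-≤ (ℕ.nonTrivial⇒n>1 p) (ℕP.m^n>0 p {{prime⇒nonZero pr}} k))

θ : (q : ℕ) → IsPrimePower q → ℕ → ℕ
θ q hq m = _/_ ((q ℕ.^ m) ∸ 1) (q ∸ 1) {{primePower⇒nz hq}}

record FiniteField (N : ℕ) : Set₁ where
  infixl 7 _*_
  infixl 6 _+_
  field
    Carrier           : Set
    _+_ _*_           : Op₂ Carrier
    -_                : Op₁ Carrier
    0# 1#             : Carrier
    isCommutativeRing : IsCommutativeRing _≡_ _+_ _*_ -_ 0# 1#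
    0≢1               : 0# ≢ 1#
    inverse           : ∀ x → x ≢ 0# → ∃[ y ] x * y ≡ 1#
    enumeration       : Carrier ↔ Fin N

  _^_ : Carrier → ℕ → Carrier
  x ^ zero  = 1#
  x ^ suc k = x * (x ^ k)

  Primitive : Carrier → Set
  Primitive η = ∀ x → x ≢ 0# → ∃[ k ] η ^ k ≡ x

-- The projective space PG(F × F) over the subfield F_q of F.
-- F_q is the subfield {λ ∈ F | λ^q = λ} (of order q when |F| is a power of q).

module PG {N : ℕ} (F : FiniteField N) (q : ℕ) where
  open FiniteField F

  Vec2 : Set
  Vec2 = Carrier × Carrier

  NonZeroV : Vec2 → Set
  NonZeroV (a , b) = ¬ (a ≡ 0# × b ≡ 0#)

  InSubfield : Carrier → Set
  InSubfield λ′ = λ′ ^ q ≡ λ′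

  -- P(v) = P(w): v and w span the same 1-dim F_q-subspace
  _∼_ : Vec2 → Vec2 → Set
  (a , b) ∼ (c , d) = ∃[ λ′ ] (InSubfield λ′ × λ′ ≢ 0# × c ≡ λ′ * a × d ≡ λ′ * b)

  -- a set of points is given as a predicate on nonzero vectors:
  -- S v means "the point P(v) belongs to the set"
  PointSet : Set₁
  PointSet = Vec2 → Set

  Π₁ : PointSet
  Π₁ v = ∃[ b ] (b ≢ 0# × v ∼ (0# , b))

  Π₂ : PointSet
  Π₂ v = ∃[ a ] (a ≢ 0# × v ∼ (a , 0#))

  𝒱 : Carrier → PointSet
  𝒱 ω v = ∃[ x ] (x ≢ 0# × v ∼ (x ^ 2 , ω * x ^ (q ℕ.+ 1)))

  HasPointCount : PointSet → ℕ → Set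
  HasPointCount S k =
    Σ (Fin k → Vec2) λ r →
        (∀ i → NonZeroV (r i) × S (r i))
      × (∀ i j → r i ∼ r j → i ≡ j)
      × (∀ v → NonZeroV v → S v → ∃[ i ] v ∼ r i)

  iter : (Vec2 → Vec2) → ℕ → Vec2 → Vec2
  iter f zero    v = v
  iter f (suc k) v = f (iter f k v)

  IsIdentityProj : (Vec2 → Vec2) → Set
  IsIdentityProj f = ∀ v → NonZeroV v → f v ∼ v

  ProjOrder : (Vec2 → Vec2) → ℕ → Set
  ProjOrder f k =
      0 ℕ.< k
    × IsIdentityProj (iter f k)
    × (∀ j → 0 ℕ.< j → j ℕ.< k → ¬ IsIdentityProj (iter f j))

  MapsOnto : (Vec2 → Vec2) → PointSet → PointSet → Set
  MapsOnto f S T =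
      (∀ v → NonZeroV v → S v → T (f v))
    × (∀ w → NonZeroV w → T w → ∃[ v ] (NonZeroV v × S v × f v ∼ w))

  ActsRegularly : (Vec2 → Vec2) → ℕ → PointSet → Set
  ActsRegularly f k S =
      (∀ v → NonZeroV v → S v → S (f v))
    × (∀ v w → NonZeroV v → NonZeroV w → S v → S w →
         ∃[ j ] (j ℕ.< k × iter f j v ∼ w))
    × (∀ v j → NonZeroV v → S v → j ℕ.< k → iter f j v ∼ v → j ≡ 0)

  φ : Carrier → Vec2 → Vec2
  φ η (a , b) = (η ^ 2 * a , η ^ (q ℕ.+ 1) * b)

  ψ : Carrier → Vec2 → Vec2
  ψ δ (a , b) = (a , δ * b)

{-# OPTIONS --safe #-}
-- A primitive element η of F = 𝔽_{q^{2n+1}} has order q^{2n+1} - 1 = θ (q - 1), with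
-- θ = 1 + q + ⋯ + q^{2n}, and 𝔽_q^* = ⟨η^θ⟩.  Each of Π₁, Π₂ and 𝒱_ω is the image of F^* under a
-- parametrisation x ↦ P(u(x)) that is constant on 𝔽_q^*-cosets, and φ multiplies the parameter by
-- η^e with e = q + 1, 2 and 1 respectively.  Since θ = 1 + q (q + 1) (1 + q² + ⋯ + q^{2n-2}) is odd
-- and (q + 1)(1 + q² + ⋯ + q^{2n}) = 1 + q θ, both 2 and q + 1 are invertible modulo θ, so ⟨η^e⟩
-- acts regularly on F^*/𝔽_q^* ≅ ℤ/θ.  This gives (ii); (i) counts a regular orbit, and (iii) is a
-- direct computation.
module Submission where

open import Defs
open import Level using (0ℓ)
open import Data.Nat as ℕ using (ℕ; zero; suc; _+_; _*_; _∸_; _≤_; _<_; z≤n; s≤s; NonZero; _%_; _/_)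
import Data.Nat.Properties as ℕ
open import Data.Nat.DivMod using (m≡m%n+[m/n]*n; m%n<n; m<n⇒m%n≡m; m*n/n≡m)
open import Data.Nat.Tactic.RingSolver using (solve-∀)
open import Data.Nat.Divisibility
  using (_∣_; m%n≡0⇒n∣m; n∣m⇒m%n≡0; ∣m+n∣m⇒∣n; ∣n⇒∣m*n; m∣m*n; *-cancelʳ-∣)
open import Data.Fin using (Fin; toℕ; fromℕ<; punchOut)
import Data.Fin.Properties as Fin
import Data.Fin as Fin
open import Data.Product using (∃-syntax; ∃₂; _×_; _,_; proj₁; proj₂)
open import Data.Empty using (⊥-elim)
open import Data.Sum using (inj₁; inj₂)
open import Function using (_∘_)
open import Function.Bundles using (Inverse; Injection)
open import Function.Properties.Inverse using (↔⇒↣; ↔-sym)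
open import Relation.Binary.Definitions using (DecidableEquality)
open import Relation.Nullary using (yes; no; contradiction)
open import Relation.Nullary.Decidable using (via-injection)
open import Relation.Binary.PropositionalEquality
open import Algebra.Bundles using (CommutativeRing)

module FieldProperties {N : ℕ} (F : FiniteField N) where
  open FiniteField F renaming (_*_ to _·_; _+_ to _⊕_)
  open ≡-Reasoning

  commutativeRing : CommutativeRing 0ℓ 0ℓ
  commutativeRing = record
    { Carrier = Carrier ; _≈_ = _≡_ ; _+_ = _⊕_ ; _*_ = _·_ ; -_ = -_ ; 0# = 0# ; 1# = 1#
    ; isCommutativeRing = isCommutativeRing }

  open CommutativeRing commutativeRing public
    using ( *-comm; *-assoc; *-identityˡ; *-identityʳ; zeroˡ; zeroʳ
          ; *-commutativeSemigroup; commutativeSemiring)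
  open import Algebra.Properties.CommutativeSemigroup *-commutativeSemigroup public
    using (x∙yz≈y∙xz)
  import Algebra.Properties.CommutativeSemiring.Exp commutativeSemiring as Exp

  ^≗Exp^ : ∀ x k → x ^ k ≡ x Exp.^ k
  ^≗Exp^ x zero    = refl
  ^≗Exp^ x (suc k) = cong (x ·_) (^≗Exp^ x k)

  ^-distribˡ-+-· : ∀ x m n → x ^ (m + n) ≡ x ^ m · x ^ n
  ^-distribˡ-+-· x m n rewrite ^≗Exp^ x (m + n) | ^≗Exp^ x m | ^≗Exp^ x n = Exp.^-homo-* x m n

  ^-*-assoc : ∀ x m n → (x ^ m) ^ n ≡ x ^ (m * n)
  ^-*-assoc x m n rewrite ^≗Exp^ (x ^ m) n | ^≗Exp^ x m | ^≗Exp^ x (m * n) = Exp.^-assocʳ x m n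

  ^-distribʳ-· : ∀ x y n → (x · y) ^ n ≡ x ^ n · y ^ n
  ^-distribʳ-· x y n rewrite ^≗Exp^ (x · y) n | ^≗Exp^ x n | ^≗Exp^ y n = Exp.^-distrib-* x y n

  ^-zeroˡ : ∀ n → 1# ^ n ≡ 1#
  ^-zeroˡ zero    = refl
  ^-zeroˡ (suc n) = trans (*-identityˡ _) (^-zeroˡ n)

  inv : ∀ x → x ≢ 0# → Carrier
  inv x x≢0 = proj₁ (inverse x x≢0)

  ·-inverseʳ : ∀ x (x≢0 : x ≢ 0#) → x · inv x x≢0 ≡ 1#
  ·-inverseʳ x x≢0 = proj₂ (inverse x x≢0)

  ·-inverseˡ : ∀ x (x≢0 : x ≢ 0#) → inv x x≢0 · x ≡ 1#
  ·-inverseˡ x x≢0 = trans (*-comm _ _) (·-inverseʳ x x≢0)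

  1≢0 : 1# ≢ 0#
  1≢0 = 0≢1 ∘ sym

  inv-solve : ∀ {a x y} (a≢0 : a ≢ 0#) → y ≡ a · x → x ≡ inv a a≢0 · y
  inv-solve {a} {x} {y} a≢0 y≡ax = begin
    x                    ≡⟨ *-identityˡ x ⟨
    1# · x               ≡⟨ cong (_· x) (·-inverseˡ a a≢0) ⟨
    (inv a a≢0 · a) · x  ≡⟨ *-assoc _ a x ⟩
    inv a a≢0 · (a · x)  ≡⟨ cong (inv a a≢0 ·_) y≡ax ⟨
    inv a a≢0 · y        ∎

  ·-cancelˡ : ∀ {a x y} → a ≢ 0# → a · x ≡ a · y → x ≡ y
  ·-cancelˡ a≢0 ax≡ay = trans (inv-solve a≢0 refl) (sym (inv-solve a≢0 ax≡ay))

  ·-cancelʳ : ∀ {a x y} → a ≢ 0# → x · a ≡ y · a → x ≡ y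
  ·-cancelʳ {a} {x} {y} a≢0 xa≡ya = ·-cancelˡ a≢0 (trans (*-comm a x) (trans xa≡ya (*-comm y a)))

  ·≡0⇒≡0 : ∀ {a b} → a ≢ 0# → a · b ≡ 0# → b ≡ 0#
  ·≡0⇒≡0 {a} a≢0 ab≡0 = ·-cancelˡ a≢0 (trans ab≡0 (sym (zeroʳ a)))

  ·-nonzero : ∀ {a b} → a ≢ 0# → b ≢ 0# → a · b ≢ 0#
  ·-nonzero a≢0 b≢0 = b≢0 ∘ ·≡0⇒≡0 a≢0

  ^-nonzero : ∀ {x} n → x ≢ 0# → x ^ n ≢ 0#
  ^-nonzero zero    _   = 1≢0
  ^-nonzero (suc n) x≢0 = ·-nonzero x≢0 (^-nonzero n x≢0)

  inv-nonzero : ∀ x (x≢0 : x ≢ 0#) → inv x x≢0 ≢ 0#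
  inv-nonzero x x≢0 inv≡0 = 1≢0 (trans (sym (·-inverseʳ x x≢0)) (trans (cong (x ·_) inv≡0) (zeroʳ x)))

  x^a≡x^[a%g] : ∀ {x} g .{{_ : NonZero g}} → x ^ g ≡ 1# → ∀ a → x ^ a ≡ x ^ (a % g)
  x^a≡x^[a%g] {x} g x^g≡1 a = begin
    x ^ a                              ≡⟨ cong (x ^_) (m≡m%n+[m/n]*n a g) ⟩
    x ^ (a % g + a / g * g)            ≡⟨ ^-distribˡ-+-· x (a % g) _ ⟩
    x ^ (a % g) · x ^ (a / g * g)      ≡⟨ cong (λ k → x ^ (a % g) · x ^ k) (ℕ.*-comm (a / g) g) ⟩
    x ^ (a % g) · x ^ (g * (a / g))    ≡⟨ cong (x ^ (a % g) ·_) (^-*-assoc x g (a / g)) ⟨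
    x ^ (a % g) · (x ^ g) ^ (a / g)    ≡⟨ cong (λ y → x ^ (a % g) · y ^ (a / g)) x^g≡1 ⟩
    x ^ (a % g) · 1# ^ (a / g)         ≡⟨ cong (x ^ (a % g) ·_) (^-zeroˡ (a / g)) ⟩
    x ^ (a % g) · 1#                   ≡⟨ *-identityʳ _ ⟩
    x ^ (a % g)                        ∎

  _≟_ : DecidableEquality Carrier
  _≟_ = via-injection (↔⇒↣ enumeration) Fin._≟_

  to-injective : ∀ {x y} → Inverse.to enumeration x ≡ Inverse.to enumeration y → x ≡ y
  to-injective = Injection.injective (↔⇒↣ enumeration)

  injective-on-F*⇒N≤1+m : ∀ {m} (h : ∀ x → x ≢ 0# → Fin m) →
         (∀ {x y} x≢0 y≢0 → h x x≢0 ≡ h y y≢0 → x ≡ y) → N ≤ suc m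
  injective-on-F*⇒N≤1+m {m} h h-injective =
    Fin.injective⇒≤ {f = extend ∘ Inverse.from enumeration}
      (Injection.injective (↔⇒↣ (↔-sym enumeration)) ∘ extend-injective)
    where
    extend : Carrier → Fin (suc m)
    extend x with x ≟ 0#
    ... | yes _   = Fin.zero
    ... | no x≢0 = Fin.suc (h x x≢0)
    extend-injective : ∀ {x y} → extend x ≡ extend y → x ≡ y
    extend-injective {x} {y} with x ≟ 0# | y ≟ 0#
    ... | yes refl | yes refl = λ _ → refl
    ... | yes _    | no _     = λ ()
    ... | no _     | yes _    = λ ()
    ... | no x≢0  | no y≢0  = h-injective x≢0 y≢0 ∘ Fin.suc-injective

  x^i≡x^j⇒x^[j∸i]≡1 : ∀ {x i j} → x ≢ 0# → i ≤ j → x ^ i ≡ x ^ j → x ^ (j ∸ i) ≡ 1#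
  x^i≡x^j⇒x^[j∸i]≡1 {x} {i} {j} x≢0 i≤j x^i≡x^j = ·-cancelˡ (^-nonzero i x≢0) (begin
    x ^ i · x ^ (j ∸ i)  ≡⟨ ^-distribˡ-+-· x i (j ∸ i) ⟨
    x ^ (i + (j ∸ i))    ≡⟨ cong (x ^_) (ℕ.m+[n∸m]≡n i≤j) ⟩
    x ^ j                ≡⟨ x^i≡x^j ⟨
    x ^ i                ≡⟨ *-identityʳ _ ⟨
    x ^ i · 1#           ∎)

∃-power≡1 : ∀ {N} (F : FiniteField N) → let open FiniteField F in
            ∀ {x} → x ≢ 0# → ∃[ d ] (0 < d × d ≤ N ∸ 1 × x ^ d ≡ 1#)
∃-power≡1 {zero} F _ = ⊥-elim (Fin.¬Fin0 (Inverse.to (FiniteField.enumeration F) (FiniteField.0# F)))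
∃-power≡1 {suc K} F {x} x≢0 = power-collision (Fin.pigeonhole (ℕ.n<1+n K) (λ i → punchOut (0≢x^ i)))
  where
  open FiniteField F
  open FieldProperties F
  0≢x^ : ∀ i → Inverse.to enumeration 0# ≢ Inverse.to enumeration (x ^ toℕ i)
  0≢x^ i e = ^-nonzero (toℕ i) x≢0 (to-injective (sym e))
  power-collision : ∃₂ (λ i j → i Fin.< j × punchOut (0≢x^ i) ≡ punchOut (0≢x^ j)) →
                    ∃[ d ] (0 < d × d ≤ K × x ^ d ≡ 1#)
  power-collision (i , j , i<j , same) =
    toℕ j ∸ toℕ i ,
    ℕ.m<n⇒0<n∸m i<j ,
    ℕ.≤-trans (ℕ.m∸n≤m (toℕ j) (toℕ i)) (ℕ.≤-pred (Fin.toℕ<n j)) ,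
    x^i≡x^j⇒x^[j∸i]≡1 x≢0 (ℕ.<⇒≤ i<j) (to-injective (Fin.punchOut-injective (0≢x^ i) (0≢x^ j) same))

module PrimitiveElement {N : ℕ} (F : FiniteField N) (2<N : 2 < N)
                        {η : FiniteField.Carrier F} (η-primitive : FiniteField.Primitive F η) where
  open FiniteField F renaming (_*_ to _·_)
  open FieldProperties F
  open ≡-Reasoning

  log : ∀ x → x ≢ 0# → ℕ
  log x x≢0 = proj₁ (η-primitive x x≢0)

  η^log : ∀ x (x≢0 : x ≢ 0#) → η ^ log x x≢0 ≡ x
  η^log x x≢0 = proj₂ (η-primitive x x≢0)

  -- Otherwise every nonzero element would be a power of 0#, hence equal to 1#.
  η≢0 : η ≢ 0#
  η≢0 η≡0 = ℕ.<⇒≱ 2<N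
    (injective-on-F*⇒N≤1+m (λ _ _ → Fin.zero) (λ x≢0 y≢0 _ → trans (≡1 x≢0) (sym (≡1 y≢0))))
    where
    ≡1 : ∀ {x} → x ≢ 0# → x ≡ 1#
    ≡1 {x} x≢0 with log x x≢0 | η^log x x≢0
    ... | zero  | 1≡x    = sym 1≡x
    ... | suc k | η^1+k≡x =
      contradiction (trans (sym η^1+k≡x) (trans (cong (_· η ^ k) η≡0) (zeroˡ _))) x≢0

  N∸1≤period : ∀ g .{{_ : NonZero g}} → η ^ g ≡ 1# → N ∸ 1 ≤ g
  N∸1≤period g η^g≡1 =
    ℕ.∸-monoˡ-≤ 1 (injective-on-F*⇒N≤1+m (λ x x≢0 → fromℕ< (m%n<n (log x x≢0) g)) log%g-injective)
    where
    log%g-injective : ∀ {x y} x≢0 y≢0 →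
                      fromℕ< (m%n<n (log x x≢0) g) ≡ fromℕ< (m%n<n (log y y≢0) g) → x ≡ y
    log%g-injective {x} {y} x≢0 y≢0 same = begin
      x                      ≡⟨ η^log x x≢0 ⟨
      η ^ log x x≢0          ≡⟨ x^a≡x^[a%g] g η^g≡1 _ ⟩
      η ^ (log x x≢0 % g)    ≡⟨ cong (η ^_) (Fin.fromℕ<-injective _ _ _ _ same) ⟩
      η ^ (log y y≢0 % g)    ≡⟨ x^a≡x^[a%g] g η^g≡1 _ ⟨
      η ^ log y y≢0          ≡⟨ η^log y y≢0 ⟩
      y                      ∎

  private instance
    N∸1-nonZero : NonZero (N ∸ 1)
    N∸1-nonZero = ℕ.>-nonZero (ℕ.m<n⇒0<n∸m (ℕ.<-trans (ℕ.n<1+n 1) 2<N))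

  η^[N∸1]≡1 : η ^ (N ∸ 1) ≡ 1#
  η^[N∸1]≡1 with d , 0<d , d≤N∸1 , η^d≡1 ← ∃-power≡1 F η≢0 =
    subst (λ k → η ^ k ≡ 1#) (ℕ.≤-antisym d≤N∸1 (N∸1≤period d {{ℕ.>-nonZero 0<d}} η^d≡1)) η^d≡1

  η^a≡1⇒N∸1∣a : ∀ a → η ^ a ≡ 1# → N ∸ 1 ∣ a
  η^a≡1⇒N∸1∣a a η^a≡1 with a % (N ∸ 1) in a%≡
  ... | zero  = m%n≡0⇒n∣m a (N ∸ 1) a%≡
  ... | suc r =
    contradiction (subst (_< N ∸ 1) a%≡ (m%n<n a (N ∸ 1))) (ℕ.≤⇒≯ (N∸1≤period (suc r) η^1+r≡1))
    where
    η^1+r≡1 : η ^ suc r ≡ 1#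
    η^1+r≡1 = trans (cong (η ^_) (sym a%≡)) (trans (sym (x^a≡x^[a%g] (N ∸ 1) η^[N∸1]≡1 a)) η^a≡1)

repunit : ℕ → ℕ → ℕ
repunit q zero    = 0
repunit q (suc m) = 1 + q * repunit q m

repunit-geometric : ∀ p m → p * repunit (suc p) m + 1 ≡ suc p ℕ.^ m
repunit-geometric p zero    = cong (_+ 1) (ℕ.*-zeroʳ p)
repunit-geometric p (suc m) = begin
  p * (1 + suc p * r) + 1  ≡⟨ step p r ⟩
  suc p * (p * r + 1)      ≡⟨ cong (suc p *_) (repunit-geometric p m) ⟩
  suc p * suc p ℕ.^ m      ∎
  where
  open ≡-Reasoning
  r = repunit (suc p) m
  step : ∀ p r → p * (1 + suc p * r) + 1 ≡ suc p * (p * r + 1)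
  step = solve-∀

θ≡repunit : ∀ p (hq : IsPrimePower (suc p)) m → θ (suc p) hq m ≡ repunit (suc p) m
θ≡repunit p hq m = begin
  (suc p ℕ.^ m ∸ 1) / p      ≡⟨ cong (λ k → (k ∸ 1) / p) (repunit-geometric p m) ⟨
  (p * r + 1 ∸ 1) / p        ≡⟨ cong (_/ p) (ℕ.m+n∸n≡m (p * r) 1) ⟩
  (p * r) / p                ≡⟨ cong (_/ p) (ℕ.*-comm p r) ⟩
  (r * p) / p                ≡⟨ m*n/n≡m r p ⟩
  r                          ∎
  where
  open ≡-Reasoning
  r = repunit (suc p) m
  instance
    p-nonZero : NonZero p
    p-nonZero = primePower⇒nz hq

q^m∸1≡θ*[q∸1] : ∀ p (hq : IsPrimePower (suc p)) m → suc p ℕ.^ m ∸ 1 ≡ θ (suc p) hq m * p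
q^m∸1≡θ*[q∸1] p hq m = begin
  suc p ℕ.^ m ∸ 1              ≡⟨ cong (_∸ 1) (repunit-geometric p m) ⟨
  p * repunit (suc p) m + 1 ∸ 1 ≡⟨ ℕ.m+n∸n≡m (p * repunit (suc p) m) 1 ⟩
  p * repunit (suc p) m         ≡⟨ ℕ.*-comm p _ ⟩
  repunit (suc p) m * p         ≡⟨ cong (_* p) (θ≡repunit p hq m) ⟨
  θ (suc p) hq m * p            ∎
  where open ≡-Reasoning

2<q^[2n+1] : ∀ q n → 2 ≤ q → 1 ≤ n → 2 < q ℕ.^ (2 * n + 1)
2<q^[2n+1] q n 2≤q 1≤n =
  ℕ.≤-<-trans (subst (2 ≤_) (sym (ℕ.*-identityʳ q)) 2≤q)
              (ℕ.^-monoʳ-< q 2≤q (ℕ.≤-trans (ℕ.*-monoʳ-≤ 2 1≤n) (ℕ.m≤m+n (2 * n) 1)))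

repunit-even : ∀ q n → repunit q (2 * n) ≡ (1 + q) * repunit (q * q) n
repunit-even q zero    = sym (ℕ.*-zeroʳ (1 + q))
repunit-even q (suc n) = begin
  repunit q (2 * suc n)                       ≡⟨ cong (repunit q) (ℕ.*-suc 2 n) ⟩
  1 + q * (1 + q * repunit q (2 * n))         ≡⟨ cong (λ r → 1 + q * (1 + q * r)) (repunit-even q n) ⟩
  1 + q * (1 + q * ((1 + q) * r))             ≡⟨ step q r ⟩
  (1 + q) * (1 + q * q * r)                   ∎
  where
  open ≡-Reasoning
  r = repunit (q * q) n
  step : ∀ q r → 1 + q * (1 + q * ((1 + q) * r)) ≡ (1 + q) * (1 + q * q * r)
  step = solve-∀

repunit-odd : ∀ q n → repunit q (2 * n + 1) ≡ 1 + q * (1 + q) * repunit (q * q) n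
repunit-odd q n = begin
  repunit q (2 * n + 1)                 ≡⟨ cong (repunit q) (ℕ.+-comm (2 * n) 1) ⟩
  1 + q * repunit q (2 * n)             ≡⟨ cong (λ r → 1 + q * r) (repunit-even q n) ⟩
  1 + q * ((1 + q) * repunit (q * q) n) ≡⟨ cong suc (ℕ.*-assoc q (1 + q) _) ⟨
  1 + q * (1 + q) * repunit (q * q) n   ∎
  where open ≡-Reasoning

pronic-even : ∀ q → ∃[ t ] q * (1 + q) ≡ 2 * t
pronic-even zero    = 0 , refl
pronic-even (suc q) with t , q[1+q]≡2t ← pronic-even q = t + (1 + q) , (begin
  suc q * (2 + q)            ≡⟨ step q ⟩
  q * (1 + q) + 2 * (1 + q)  ≡⟨ cong (_+ 2 * (1 + q)) q[1+q]≡2t ⟩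
  2 * t + 2 * (1 + q)        ≡⟨ ℕ.*-distribˡ-+ 2 t (1 + q) ⟨
  2 * (t + (1 + q))          ∎)
  where
  open ≡-Reasoning
  step : ∀ q → suc q * (2 + q) ≡ q * (1 + q) + 2 * (1 + q)
  step = solve-∀

record _InvertibleMod_ (e m : ℕ) : Set where
  constructor inverseMod
  field
    e′ c : ℕ
    e*e′≡1+m*c : e * e′ ≡ 1 + m * c

1-invertibleMod : ∀ m → 1 InvertibleMod m
1-invertibleMod m = inverseMod 1 0 (cong suc (sym (ℕ.*-zeroʳ m)))

2-invertibleMod-repunit : ∀ q n → 2 InvertibleMod repunit q (2 * n + 1)
2-invertibleMod-repunit q n with t , q[1+q]≡2t ← pronic-even q = inverseMod (1 + t * r) 1 (begin
  2 * (1 + t * r)                ≡⟨ step t r ⟩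
  1 + (1 + 2 * t * r) * 1        ≡⟨ cong (λ k → 1 + (1 + k * r) * 1) q[1+q]≡2t ⟨
  1 + (1 + q * (1 + q) * r) * 1  ≡⟨ cong (λ k → 1 + k * 1) (repunit-odd q n) ⟨
  1 + repunit q (2 * n + 1) * 1  ∎)
  where
  open ≡-Reasoning
  r = repunit (q * q) n
  step : ∀ t r → 2 * (1 + t * r) ≡ 1 + (1 + 2 * t * r) * 1
  step = solve-∀

1+q-invertibleMod-repunit : ∀ q n → (q + 1) InvertibleMod repunit q (2 * n + 1)
1+q-invertibleMod-repunit q n = inverseMod (1 + q * q * r) q (begin
  (q + 1) * (1 + q * q * r)      ≡⟨ step q r ⟩
  1 + (1 + q * (1 + q) * r) * q  ≡⟨ cong (λ k → 1 + k * q) (repunit-odd q n) ⟨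
  1 + repunit q (2 * n + 1) * q  ∎)
  where
  open ≡-Reasoning
  r = repunit (q * q) n
  step : ∀ q r → (q + 1) * (1 + q * q * r) ≡ 1 + (1 + q * (1 + q) * r) * q
  step = solve-∀

invertibleMod-cancel : ∀ {e m j} → e InvertibleMod m → m ∣ e * j → m ∣ j
invertibleMod-cancel {e} {m} {j} (inverseMod e′ c ee′≡1+mc) m∣ej =
  ∣m+n∣m⇒∣n (subst (m ∣_) e′ej≡ (∣n⇒∣m*n e′ m∣ej)) (m∣m*n (c * j))
  where
  open ≡-Reasoning
  e′ej≡ : e′ * (e * j) ≡ m * (c * j) + j
  e′ej≡ = begin
    e′ * (e * j)      ≡⟨ step₁ e′ e j ⟩
    j * (e * e′)      ≡⟨ cong (j *_) ee′≡1+mc ⟩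
    j * (1 + m * c)   ≡⟨ step₂ j m c ⟩
    m * (c * j) + j   ∎
    where
    step₁ : ∀ e′ e j → e′ * (e * j) ≡ j * (e * e′)
    step₁ = solve-∀
    step₂ : ∀ j m c → j * (1 + m * c) ≡ m * (c * j) + j
    step₂ = solve-∀

-- The solution is j = (b + a (m - 1)) e′ mod m, written without subtraction by taking m = 1 + m′.
invertibleMod-solve : ∀ {e m} .{{_ : NonZero m}} → e InvertibleMod m → ∀ a b →
                      ∃[ j ] (j < m × ∃₂ λ t u → a + e * j + m * t ≡ b + m * u)
invertibleMod-solve {e} {m@(suc m′)} (inverseMod e′ c ee′≡1+mc) a b =
  j , m%n<n (x * e′) m , e * s , a + c * x , (begin
    a + e * j + m * (e * s)   ≡⟨ step₁ a e j m s ⟩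
    a + e * (j + s * m)       ≡⟨ cong (λ y → a + e * y) (m≡m%n+[m/n]*n (x * e′) m) ⟨
    a + e * (x * e′)          ≡⟨ step₂ a e x e′ ⟩
    a + x * (e * e′)          ≡⟨ cong (λ y → a + x * y) ee′≡1+mc ⟩
    a + x * (1 + m * c)       ≡⟨ step₃ a b m′ c ⟩
    b + m * (a + c * x)       ∎)
  where
  open ≡-Reasoning
  x = b + a * m′
  j = (x * e′) % m
  s = (x * e′) / m
  step₁ : ∀ a e j m s → a + e * j + m * (e * s) ≡ a + e * (j + s * m)
  step₁ = solve-∀
  step₂ : ∀ a e x e′ → a + e * (x * e′) ≡ a + x * (e * e′)
  step₂ = solve-∀
  step₃ : ∀ a b m′ c → a + (b + a * m′) * (1 + suc m′ * c) ≡ b + suc m′ * (a + c * (b + a * m′))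
  step₃ = solve-∀

module Projective {N : ℕ} (F : FiniteField N) (q : ℕ) where
  open FiniteField F renaming (_*_ to _·_; _+_ to _⊕_)
  open FieldProperties F
  open PG F q
  open ≡-Reasoning

  𝔽q* : Carrier → Set
  𝔽q* λ′ = InSubfield λ′ × λ′ ≢ 0#

  𝔽q*-1 : 𝔽q* 1#
  𝔽q*-1 = ^-zeroˡ q , 1≢0

  𝔽q*-· : ∀ {a b} → 𝔽q* a → 𝔽q* b → 𝔽q* (a · b)
  𝔽q*-· {a} {b} (a^q≡a , a≢0) (b^q≡b , b≢0) =
    trans (^-distribʳ-· a b q) (cong₂ _·_ a^q≡a b^q≡b) , ·-nonzero a≢0 b≢0

  𝔽q*-inv : ∀ {a} (a∈ : 𝔽q* a) → 𝔽q* (inv a (proj₂ a∈))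
  𝔽q*-inv {a} (a^q≡a , a≢0) = ·-cancelʳ a≢0 (begin
    a⁻¹ ^ q · a          ≡⟨ cong (a⁻¹ ^ q ·_) a^q≡a ⟨
    a⁻¹ ^ q · a ^ q      ≡⟨ ^-distribʳ-· a⁻¹ a q ⟨
    (a⁻¹ · a) ^ q        ≡⟨ cong (_^ q) (·-inverseˡ a a≢0) ⟩
    1# ^ q               ≡⟨ ^-zeroˡ q ⟩
    1#                   ≡⟨ ·-inverseˡ a a≢0 ⟨
    a⁻¹ · a              ∎) , inv-nonzero a a≢0
    where a⁻¹ = inv a a≢0

  fixes⇒𝔽q* : ∀ {α x μ} → x ≢ 0# → 𝔽q* μ → x ≡ μ · (α · x) → 𝔽q* α
  fixes⇒𝔽q* {α} {x} {μ} x≢0 μ∈@(_ , μ≢0) x≡μαx = subst 𝔽q* (sym α≡μ⁻¹) (𝔽q*-inv μ∈)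
    where
    μα≡1 : μ · α ≡ 1#
    μα≡1 = ·-cancelʳ x≢0 (trans (*-assoc μ α x) (trans (sym x≡μαx) (sym (*-identityˡ x))))
    α≡μ⁻¹ : α ≡ inv μ μ≢0
    α≡μ⁻¹ = ·-cancelˡ μ≢0 (trans μα≡1 (sym (·-inverseʳ μ μ≢0)))

  ≡-scale⇒∼ : ∀ {a b c d μ} → 𝔽q* μ → c ≡ μ · a → d ≡ μ · b → (a , b) ∼ (c , d)
  ≡-scale⇒∼ {μ = μ} (μ^q≡μ , μ≢0) c≡μa d≡μb = μ , μ^q≡μ , μ≢0 , c≡μa , d≡μb

  ∼-refl : ∀ {v} → v ∼ v
  ∼-refl {a , b} = ≡-scale⇒∼ 𝔽q*-1 (sym (*-identityˡ a)) (sym (*-identityˡ b))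

  ∼-sym : ∀ {v w} → v ∼ w → w ∼ v
  ∼-sym {a , b} {c , d} (μ , μ^q≡μ , μ≢0 , c≡μa , d≡μb) =
    ≡-scale⇒∼ (𝔽q*-inv (μ^q≡μ , μ≢0)) (inv-solve μ≢0 c≡μa) (inv-solve μ≢0 d≡μb)

  ∼-trans : ∀ {u v w} → u ∼ v → v ∼ w → u ∼ w
  ∼-trans {a , b} {c , d} {e , f} (μ , μ^q≡μ , μ≢0 , c≡μa , d≡μb) (ν , ν^q≡ν , ν≢0 , e≡νc , f≡νd) =
    ≡-scale⇒∼ (𝔽q*-· (ν^q≡ν , ν≢0) (μ^q≡μ , μ≢0))
      (trans e≡νc (trans (cong (ν ·_) c≡μa) (sym (*-assoc ν μ a))))
      (trans f≡νd (trans (cong (ν ·_) d≡μb) (sym (*-assoc ν μ b))))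

  μ^[q+1]≡μ² : ∀ {μ} → 𝔽q* μ → μ ^ (q + 1) ≡ μ ^ 2
  μ^[q+1]≡μ² {μ} (μ^q≡μ , _) = trans (^-distribˡ-+-· μ q 1) (cong (_· μ ^ 1) μ^q≡μ)

  𝒱-scale : ∀ ω {μ} x → 𝔽q* μ → (x ^ 2 , ω · x ^ (q + 1)) ∼ ((μ · x) ^ 2 , ω · (μ · x) ^ (q + 1))
  𝒱-scale ω {μ} x μ∈ = ≡-scale⇒∼ (𝔽q*-· μ∈ (𝔽q*-· μ∈ 𝔽q*-1)) (^-distribʳ-· μ x 2) (begin
    ω · (μ · x) ^ (q + 1)             ≡⟨ cong (ω ·_) (^-distribʳ-· μ x (q + 1)) ⟩
    ω · (μ ^ (q + 1) · x ^ (q + 1))   ≡⟨ cong (λ y → ω · (y · x ^ (q + 1))) (μ^[q+1]≡μ² μ∈) ⟩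
    ω · (μ ^ 2 · x ^ (q + 1))         ≡⟨ x∙yz≈y∙xz ω _ _ ⟩
    μ ^ 2 · (ω · x ^ (q + 1))         ∎)

  iter-+ : ∀ f m n v → iter f (m + n) v ≡ iter f m (iter f n v)
  iter-+ f zero    n v = refl
  iter-+ f (suc m) n v = cong f (iter-+ f m n v)

  diag-∼ : ∀ α β {a b c d} → (a , b) ∼ (c , d) → (α · a , β · b) ∼ (α · c , β · d)
  diag-∼ α β (μ , μ^q≡μ , μ≢0 , c≡μa , d≡μb) =
    ≡-scale⇒∼ (μ^q≡μ , μ≢0)
      (trans (cong (α ·_) c≡μa) (x∙yz≈y∙xz α μ _))
      (trans (cong (β ·_) d≡μb) (x∙yz≈y∙xz β μ _))

  regular⇒HasPointCount : ∀ {f k S v₀} → (∀ {v} → NonZeroV v → NonZeroV (f v)) → NonZeroV v₀ → S v₀ →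
                  ActsRegularly f k S → HasPointCount S k
  regular⇒HasPointCount {f} {k} {S} {v₀} f-nonzero v₀≢0 v₀∈S (invariant , transitive , free) =
    orbit , (λ i → iterate-in-S (toℕ i)) , orbit-injective , orbit-covers
    where
    orbit : Fin k → Vec2
    orbit i = iter f (toℕ i) v₀

    iterate-in-S : ∀ j → NonZeroV (iter f j v₀) × S (iter f j v₀)
    iterate-in-S zero    = v₀≢0 , v₀∈S
    iterate-in-S (suc j) with v≢0 , v∈S ← iterate-in-S j = f-nonzero v≢0 , invariant _ v≢0 v∈S

    ≤-injective : ∀ {i j} → toℕ i ≤ toℕ j → orbit i ∼ orbit j → i ≡ j
    ≤-injective {i} {j} i≤j orbitᵢ∼orbitⱼ = Fin.toℕ-injective (begin
      toℕ i             ≡⟨ cong (_+ toℕ i) d≡0 ⟨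
      d + toℕ i         ≡⟨ ℕ.m∸n+n≡m i≤j ⟩
      toℕ j             ∎)
      where
      d = toℕ j ∸ toℕ i
      fᵈorbitᵢ≡orbitⱼ : iter f d (orbit i) ≡ orbit j
      fᵈorbitᵢ≡orbitⱼ = trans (sym (iter-+ f d (toℕ i) v₀)) (cong (λ m → iter f m v₀) (ℕ.m∸n+n≡m i≤j))
      d≡0 : d ≡ 0
      d≡0 = free (orbit i) d (proj₁ (iterate-in-S (toℕ i))) (proj₂ (iterate-in-S (toℕ i)))
                 (ℕ.≤-<-trans (ℕ.m∸n≤m (toℕ j) (toℕ i)) (Fin.toℕ<n j))
                 (subst (_∼ orbit i) (sym fᵈorbitᵢ≡orbitⱼ) (∼-sym orbitᵢ∼orbitⱼ))

    orbit-injective : ∀ i j → orbit i ∼ orbit j → i ≡ j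
    orbit-injective i j orbitᵢ∼orbitⱼ with ℕ.≤-total (toℕ i) (toℕ j)
    ... | inj₁ i≤j = ≤-injective i≤j orbitᵢ∼orbitⱼ
    ... | inj₂ j≤i = sym (≤-injective j≤i (∼-sym orbitᵢ∼orbitⱼ))

    orbit-covers : ∀ v → NonZeroV v → S v → ∃[ i ] v ∼ orbit i
    orbit-covers v v≢0 v∈S with j , j<k , fʲv₀∼v ← transitive v₀ v v₀≢0 v≢0 v₀∈S v∈S =
      fromℕ< j<k , subst (λ m → v ∼ iter f m v₀) (sym (Fin.toℕ-fromℕ< j<k)) (∼-sym fʲv₀∼v)

  ψ-∼ : ∀ δ {v w} → v ∼ w → ψ δ v ∼ ψ δ w
  ψ-∼ δ {a , b} {c , d} (μ , μ^q≡μ , μ≢0 , c≡μa , d≡μb) =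
    ≡-scale⇒∼ (μ^q≡μ , μ≢0) c≡μa (trans (cong (δ ·_) d≡μb) (x∙yz≈y∙xz δ μ b))

  ψ-maps-𝒱 : ∀ δ ω → MapsOnto (ψ δ) (𝒱 ω) (𝒱 (δ · ω))
  ψ-maps-𝒱 δ ω = forward , backward
    where
    reassoc : ∀ x → ψ δ (x ^ 2 , ω · x ^ (q + 1)) ≡ (x ^ 2 , (δ · ω) · x ^ (q + 1))
    reassoc x = cong (x ^ 2 ,_) (sym (*-assoc δ ω _))
    forward : ∀ v → NonZeroV v → 𝒱 ω v → 𝒱 (δ · ω) (ψ δ v)
    forward v _ (x , x≢0 , v∼) = x , x≢0 , subst (ψ δ v ∼_) (reassoc x) (ψ-∼ δ v∼)
    backward : ∀ w → NonZeroV w → 𝒱 (δ · ω) w → ∃[ v ] (NonZeroV v × 𝒱 ω v × ψ δ v ∼ w)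
    backward w _ (x , x≢0 , w∼) =
      (x ^ 2 , ω · x ^ (q + 1)) , ^-nonzero 2 x≢0 ∘ proj₁ , (x , x≢0 , ∼-refl) ,
      subst (_∼ w) (sym (reassoc x)) (∼-sym w∼)

  ψ-maps-Π₁ : ∀ {δ} → δ ≢ 0# → MapsOnto (ψ δ) Π₁ Π₁
  ψ-maps-Π₁ {δ} δ≢0 = forward , backward
    where
    forward : ∀ v → NonZeroV v → Π₁ v → Π₁ (ψ δ v)
    forward v _ (b , b≢0 , v∼) = δ · b , ·-nonzero δ≢0 b≢0 , ψ-∼ δ v∼
    backward : ∀ w → NonZeroV w → Π₁ w → ∃[ v ] (NonZeroV v × Π₁ v × ψ δ v ∼ w)
    backward w _ (c , c≢0 , w∼) =
      (0# , δ⁻¹c) , δ⁻¹c≢0 ∘ proj₂ , (δ⁻¹c , δ⁻¹c≢0 , ∼-refl) ,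
      subst (_∼ w) (cong (0# ,_) (sym δδ⁻¹c≡c)) (∼-sym w∼)
      where
      δ⁻¹c = inv δ δ≢0 · c
      δ⁻¹c≢0 : δ⁻¹c ≢ 0#
      δ⁻¹c≢0 = ·-nonzero (inv-nonzero δ δ≢0) c≢0
      δδ⁻¹c≡c : δ · δ⁻¹c ≡ c
      δδ⁻¹c≡c = trans (sym (*-assoc δ _ c)) (trans (cong (_· c) (·-inverseʳ δ δ≢0)) (*-identityˡ c))

  ψ-maps-Π₂ : ∀ δ → MapsOnto (ψ δ) Π₂ Π₂
  ψ-maps-Π₂ δ = forward , backward
    where
    forward : ∀ v → NonZeroV v → Π₂ v → Π₂ (ψ δ v)
    forward v _ (a , a≢0 , v∼) = a , a≢0 , subst (ψ δ v ∼_) (cong (a ,_) (zeroʳ δ)) (ψ-∼ δ v∼)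
    backward : ∀ w → NonZeroV w → Π₂ w → ∃[ v ] (NonZeroV v × Π₂ v × ψ δ v ∼ w)
    backward w _ (c , c≢0 , w∼) =
      (c , 0#) , c≢0 ∘ proj₁ , (c , c≢0 , ∼-refl) ,
      subst (_∼ w) (cong (c ,_) (sym (zeroʳ δ))) (∼-sym w∼)

module SingerCycle {N : ℕ} (F : FiniteField N) (2<N : 2 < N)
                   {η : FiniteField.Carrier F} (η-primitive : FiniteField.Primitive F η)
                   (p Θ : ℕ) .{{_ : NonZero p}} .{{_ : NonZero Θ}} (N∸1≡Θ*p : N ∸ 1 ≡ Θ * p)
                   (2-invertible : 2 InvertibleMod Θ)
                   (q+1-invertible : (suc p + 1) InvertibleMod Θ) where
  open FiniteField F renaming (_*_ to _·_; _+_ to _⊕_)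
  open FieldProperties F
  open PrimitiveElement F 2<N η-primitive
  open ≡-Reasoning

  private
    q : ℕ
    q = suc p

  open PG F q
  open Projective F q

  η^[Θ*p*t]≡1 : ∀ t → η ^ (Θ * p * t) ≡ 1#
  η^[Θ*p*t]≡1 t = begin
    η ^ (Θ * p * t)       ≡⟨ ^-*-assoc η (Θ * p) t ⟨
    (η ^ (Θ * p)) ^ t     ≡⟨ cong (λ k → (η ^ k) ^ t) N∸1≡Θ*p ⟨
    (η ^ (N ∸ 1)) ^ t     ≡⟨ cong (_^ t) η^[N∸1]≡1 ⟩
    1# ^ t                ≡⟨ ^-zeroˡ t ⟩
    1#                    ∎

  η^[Θ*t]∈𝔽q* : ∀ t → 𝔽q* (η ^ (Θ * t))
  η^[Θ*t]∈𝔽q* t = (begin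
    (η ^ (Θ * t)) ^ q               ≡⟨ ^-*-assoc η (Θ * t) q ⟩
    η ^ (Θ * t * q)                 ≡⟨ cong (η ^_) (step Θ t p) ⟩
    η ^ (Θ * t + Θ * p * t)         ≡⟨ ^-distribˡ-+-· η (Θ * t) _ ⟩
    η ^ (Θ * t) · η ^ (Θ * p * t)   ≡⟨ cong (η ^ (Θ * t) ·_) (η^[Θ*p*t]≡1 t) ⟩
    η ^ (Θ * t) · 1#                ≡⟨ *-identityʳ _ ⟩
    η ^ (Θ * t)                     ∎) , ^-nonzero (Θ * t) η≢0
    where
    step : ∀ Θ t p → Θ * t * suc p ≡ Θ * t + Θ * p * t
    step = solve-∀

  η^k∈𝔽q⇒Θ∣k : ∀ k → InSubfield (η ^ k) → Θ ∣ k
  η^k∈𝔽q⇒Θ∣k k [η^k]^q≡η^k =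
    *-cancelʳ-∣ p (subst (_∣ k * p) N∸1≡Θ*p (η^a≡1⇒N∸1∣a (k * p) η^[k*p]≡1))
    where
    η^[k*p]≡1 : η ^ (k * p) ≡ 1#
    η^[k*p]≡1 = ·-cancelˡ (^-nonzero k η≢0) (begin
      η ^ k · η ^ (k * p)   ≡⟨ ^-distribˡ-+-· η k (k * p) ⟨
      η ^ (k + k * p)       ≡⟨ cong (η ^_) (ℕ.*-suc k p) ⟨
      η ^ (k * q)           ≡⟨ ^-*-assoc η k q ⟨
      (η ^ k) ^ q           ≡⟨ [η^k]^q≡η^k ⟩
      η ^ k                 ≡⟨ *-identityʳ _ ⟨
      η ^ k · 1#            ∎)

  fixed-coordinate⇒j≡0 : ∀ {e j x μ} → e InvertibleMod Θ → j < Θ → x ≢ 0# → 𝔽q* μ →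
                          x ≡ μ · ((η ^ e) ^ j · x) → j ≡ 0
  fixed-coordinate⇒j≡0 {e} {j} e-invertible j<Θ x≢0 μ∈ x≡μη^ejx =
    trans (sym (m<n⇒m%n≡m j<Θ)) (n∣m⇒m%n≡0 j Θ (invertibleMod-cancel e-invertible Θ∣ej))
    where
    Θ∣ej : Θ ∣ e * j
    Θ∣ej = η^k∈𝔽q⇒Θ∣k (e * j) (subst InSubfield (^-*-assoc η e j) (proj₁ (fixes⇒𝔽q* x≢0 μ∈ x≡μη^ejx)))

  φ-∼ : ∀ {v w} → v ∼ w → φ η v ∼ φ η w
  φ-∼ {a , b} {c , d} = diag-∼ (η ^ 2) (η ^ (q + 1))

  iter-φ-∼ : ∀ j {v w} → v ∼ w → iter (φ η) j v ∼ iter (φ η) j w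
  iter-φ-∼ zero    v∼w = v∼w
  iter-φ-∼ (suc j) v∼w = φ-∼ (iter-φ-∼ j v∼w)

  φ-nonzero : ∀ {v} → NonZeroV v → NonZeroV (φ η v)
  φ-nonzero {a , b} v≢0 (η²a≡0 , η^[q+1]b≡0) =
    v≢0 (·≡0⇒≡0 (^-nonzero 2 η≢0) η²a≡0 , ·≡0⇒≡0 (^-nonzero (q + 1) η≢0) η^[q+1]b≡0)

  iter-φ : ∀ j a b → iter (φ η) j (a , b) ≡ ((η ^ 2) ^ j · a , (η ^ (q + 1)) ^ j · b)
  iter-φ zero    a b = sym (cong₂ _,_ (*-identityˡ a) (*-identityˡ b))
  iter-φ (suc j) a b =
    trans (cong (φ η) (iter-φ j a b)) (cong₂ _,_ (sym (*-assoc _ _ a)) (sym (*-assoc _ _ b)))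

  -- A fixed point has a nonzero coordinate, and 2 and q + 1 are both invertible modulo Θ.
  φ-semiregular : ∀ v j → NonZeroV v → j < Θ → iter (φ η) j v ∼ v → j ≡ 0
  φ-semiregular (a , b) j v≢0 j<Θ fixed
    with μ , μ^q≡μ , μ≢0 , a≡ , b≡ ← subst (_∼ (a , b)) (iter-φ j a b) fixed | a ≟ 0#
  ... | no a≢0  = fixed-coordinate⇒j≡0 2-invertible j<Θ a≢0 (μ^q≡μ , μ≢0) a≡
  ... | yes a≡0 = fixed-coordinate⇒j≡0 q+1-invertible j<Θ (λ b≡0 → v≢0 (a≡0 , b≡0)) (μ^q≡μ , μ≢0) b≡

  φ^Θ-identity : IsIdentityProj (iter (φ η) Θ)
  φ^Θ-identity (a , b) _ = subst (_∼ (a , b)) (sym (trans (iter-φ Θ a b) same-factor))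
                             (∼-sym (≡-scale⇒∼ λ∈𝔽q* refl refl))
    where
    λ′ = (η ^ 2) ^ Θ
    λ∈𝔽q* : 𝔽q* λ′
    λ∈𝔽q* = subst 𝔽q* (trans (cong (η ^_) (ℕ.*-comm Θ 2)) (sym (^-*-assoc η 2 Θ))) (η^[Θ*t]∈𝔽q* 2)
    same-factor : (λ′ · a , (η ^ (q + 1)) ^ Θ · b) ≡ (λ′ · a , λ′ · b)
    same-factor = cong (λ y → λ′ · a , y · b) (begin
      (η ^ (q + 1)) ^ Θ                ≡⟨ ^-*-assoc η (q + 1) Θ ⟩
      η ^ ((q + 1) * Θ)                ≡⟨ cong (η ^_) (step p Θ) ⟩
      η ^ (2 * Θ + Θ * p * 1)          ≡⟨ ^-distribˡ-+-· η (2 * Θ) _ ⟩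
      η ^ (2 * Θ) · η ^ (Θ * p * 1)    ≡⟨ cong (η ^ (2 * Θ) ·_) (η^[Θ*p*t]≡1 1) ⟩
      η ^ (2 * Θ) · 1#                 ≡⟨ *-identityʳ _ ⟩
      η ^ (2 * Θ)                      ≡⟨ ^-*-assoc η 2 Θ ⟨
      λ′                               ∎)
      where
      step : ∀ p Θ → (suc p + 1) * Θ ≡ 2 * Θ + Θ * p * 1
      step = solve-∀

  φ-order : ProjOrder (φ η) Θ
  φ-order = ℕ.>-nonZero⁻¹ Θ , φ^Θ-identity , λ j 0<j j<Θ φʲ-identity →
    ℕ.<⇒≢ 0<j (sym (φ-semiregular (1# , 1#) j [1,1]≢0 j<Θ (φʲ-identity (1# , 1#) [1,1]≢0)))
    where
    [1,1]≢0 : NonZeroV (1# , 1#)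
    [1,1]≢0 = 1≢0 ∘ proj₁

  module Orbit (param : Carrier → Vec2) (e : ℕ) (e-invertible : e InvertibleMod Θ)
               (param-nonzero : ∀ {x} → x ≢ 0# → NonZeroV (param x))
               (param-scale : ∀ {μ} x → 𝔽q* μ → param x ∼ param (μ · x))
               (φ-param : ∀ x → φ η (param x) ≡ param (η ^ e · x)) where

    Image : PointSet
    Image v = ∃[ x ] (x ≢ 0# × v ∼ param x)

    iter-φ-param : ∀ j x → iter (φ η) j (param x) ≡ param ((η ^ e) ^ j · x)
    iter-φ-param zero    x = cong param (sym (*-identityˡ x))
    iter-φ-param (suc j) x =
      trans (cong (φ η) (iter-φ-param j x)) (trans (φ-param _) (cong param (sym (*-assoc _ _ x))))

    param-η^[k+Θ*t] : ∀ k t → param (η ^ (k + Θ * t)) ∼ param (η ^ k)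
    param-η^[k+Θ*t] k t = subst (param (η ^ (k + Θ * t)) ∼_) (cong param η^[Θ*t]η^k≡η^k)
                            (param-scale _ (𝔽q*-inv (η^[Θ*t]∈𝔽q* t)))
      where
      η^[Θ*t]η^k≡η^k : inv (η ^ (Θ * t)) (^-nonzero (Θ * t) η≢0) · η ^ (k + Θ * t) ≡ η ^ k
      η^[Θ*t]η^k≡η^k = sym (inv-solve (^-nonzero (Θ * t) η≢0)
                         (trans (^-distribˡ-+-· η k (Θ * t)) (*-comm _ _)))

    -- Writing b = η^β and c = η^γ, solve β + e j ≡ γ modulo Θ.
    φ-transitive : ∀ {b c} → b ≢ 0# → c ≢ 0# → ∃[ j ] (j < Θ × iter (φ η) j (param b) ∼ param c)
    φ-transitive {b} {c} b≢0 c≢0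
      with j , j<Θ , t , u , β+ej+Θt≡γ+Θu ← invertibleMod-solve e-invertible (log b b≢0) (log c c≢0) =
      j , j<Θ , subst (_∼ param c) (sym φʲparam-b≡)
                  (subst (param (η ^ (β + e * j)) ∼_) (cong param (η^log c c≢0)) same-coset)
      where
      β = log b b≢0
      γ = log c c≢0
      φʲb≡η^[β+e*j] : (η ^ e) ^ j · b ≡ η ^ (β + e * j)
      φʲb≡η^[β+e*j] = begin
        (η ^ e) ^ j · b          ≡⟨ cong₂ _·_ (sym (^-*-assoc η e j)) (η^log b b≢0) ⟨
        η ^ (e * j) · η ^ β      ≡⟨ *-comm _ _ ⟩
        η ^ β · η ^ (e * j)      ≡⟨ ^-distribˡ-+-· η β (e * j) ⟨
        η ^ (β + e * j)          ∎
      φʲparam-b≡ : iter (φ η) j (param b) ≡ param (η ^ (β + e * j))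
      φʲparam-b≡ = trans (iter-φ-param j b) (cong param φʲb≡η^[β+e*j])
      same-coset : param (η ^ (β + e * j)) ∼ param (η ^ γ)
      same-coset = ∼-trans (∼-sym (param-η^[k+Θ*t] (β + e * j) t))
                     (subst (λ k → param (η ^ k) ∼ param (η ^ γ)) (sym β+ej+Θt≡γ+Θu)
                            (param-η^[k+Θ*t] γ u))

    image-regular : ActsRegularly (φ η) Θ Image
    image-regular = invariant , transitive , λ v j v≢0 _ → φ-semiregular v j v≢0
      where
      invariant : ∀ v → NonZeroV v → Image v → Image (φ η v)
      invariant v _ (x , x≢0 , v∼) =
        η ^ e · x , ·-nonzero (^-nonzero e η≢0) x≢0 , subst (φ η v ∼_) (φ-param x) (φ-∼ v∼)
      transitive : ∀ v w → NonZeroV v → NonZeroV w → Image v → Image w →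
                   ∃[ j ] (j < Θ × iter (φ η) j v ∼ w)
      transitive v w _ _ (b , b≢0 , v∼) (c , c≢0 , w∼) =
        let j , j<Θ , φʲb∼c = φ-transitive b≢0 c≢0
        in j , j<Θ , ∼-trans (iter-φ-∼ j v∼) (∼-trans φʲb∼c (∼-sym w∼))

    image-count : HasPointCount Image Θ
    image-count = regular⇒HasPointCount φ-nonzero (param-nonzero 1≢0) (1# , 1≢0 , ∼-refl) image-regular

  module Π₁-orbit = Orbit (0# ,_) (q + 1) q+1-invertible (_∘ proj₂)
    (λ _ μ∈ → ≡-scale⇒∼ μ∈ (sym (zeroʳ _)) refl) (λ b → cong (_, η ^ (q + 1) · b) (zeroʳ _))

  module Π₂-orbit = Orbit (_, 0#) 2 2-invertible (_∘ proj₁)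
    (λ _ μ∈ → ≡-scale⇒∼ μ∈ refl (sym (zeroʳ _))) (λ a → cong (η ^ 2 · a ,_) (zeroʳ _))

  φ-𝒱 : ∀ ω x → φ η (x ^ 2 , ω · x ^ (q + 1)) ≡ ((η ^ 1 · x) ^ 2 , ω · (η ^ 1 · x) ^ (q + 1))
  φ-𝒱 ω x = sym (cong₂ _,_ (ηx^ 2) (trans (cong (ω ·_) (ηx^ (q + 1))) (x∙yz≈y∙xz ω _ _)))
    where
    ηx^ : ∀ m → (η ^ 1 · x) ^ m ≡ η ^ m · x ^ m
    ηx^ m = trans (^-distribʳ-· _ x m)
                  (cong (_· x ^ m) (trans (^-*-assoc η 1 m) (cong (η ^_) (ℕ.*-identityˡ m))))

  module 𝒱-orbit (ω : Carrier) = Orbit (λ x → x ^ 2 , ω · x ^ (q + 1)) 1 (1-invertibleMod Θ)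
    (λ x≢0 → ^-nonzero 2 x≢0 ∘ proj₁) (𝒱-scale ω) (φ-𝒱 ω)

open FiniteField using (Carrier; 0#; Primitive)
open PG
open import Data.Nat using (_^_)

lemma3p1 : (q n : ℕ) → (hq : IsPrimePower q) → 1 ≤ n →
    (F : FiniteField (q ^ (2 * n + 1))) →
    (η : Carrier F) → Primitive F η →
      (∀ ω → ω ≢ 0# F → HasPointCount F q (𝒱 F q ω) (θ q hq (2 * n + 1)))
      × (ProjOrder F q (φ F q η) (θ q hq (2 * n + 1))
         × ActsRegularly F q (φ F q η) (θ q hq (2 * n + 1)) (Π₁ F q)
         × ActsRegularly F q (φ F q η) (θ q hq (2 * n + 1)) (Π₂ F q)
         × (∀ ω → ω ≢ 0# F →
              ActsRegularly F q (φ F q η) (θ q hq (2 * n + 1)) (𝒱 F q ω)))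
      × (∀ δ ω → δ ≢ 0# F → ω ≢ 0# F →
           MapsOnto F q (ψ F q δ) (𝒱 F q ω) (𝒱 F q (FiniteField._*_ F δ ω))
           × MapsOnto F q (ψ F q δ) (Π₁ F q) (Π₁ F q)
           × MapsOnto F q (ψ F q δ) (Π₂ F q) (Π₂ F q))
lemma3p1 zero       _ hq _ = ⊥-elim (ℕ.≢-nonZero⁻¹ 0 {{primePower⇒nz hq}} refl)
lemma3p1 (suc zero) _ hq _ = ⊥-elim (ℕ.≢-nonZero⁻¹ 0 {{primePower⇒nz hq}} refl)
lemma3p1 q@(suc p@(suc _)) n hq 1≤n F η η-primitive =
    (λ ω _ → 𝒱-orbit.image-count ω)
  , (φ-order , Π₁-orbit.image-regular , Π₂-orbit.image-regular , λ ω _ → 𝒱-orbit.image-regular ω)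
  , λ δ ω δ≢0 _ → ψ-maps-𝒱 δ ω , ψ-maps-Π₁ δ≢0 , ψ-maps-Π₂ δ
  where
  θ≡repunit-2n+1 = θ≡repunit p hq (2 * n + 1)
  instance
    θ-nonZero : NonZero (θ q hq (2 * n + 1))
    θ-nonZero = subst NonZero (sym (trans θ≡repunit-2n+1 (repunit-odd q n))) _
  open SingerCycle F (2<q^[2n+1] q n (s≤s (s≤s z≤n)) 1≤n) η-primitive p (θ q hq (2 * n + 1))
         (q^m∸1≡θ*[q∸1] p hq (2 * n + 1))
         (subst (2 InvertibleMod_) (sym θ≡repunit-2n+1) (2-invertibleMod-repunit q n))
         (subst ((q + 1) InvertibleMod_) (sym θ≡repunit-2n+1) (1+q-invertibleMod-repunit q n))
  open Projective F q
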